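{- Let $\Gamma$ be a connected cubic graph (finite or infinite) of girth $6$ that contains a consistent $6$-cycle and in which every $3$-arc is contained in a $6$-cycle. Then $\Gamma$ is isomorphic to the Heawood graph, the Pappus graph, or the Desargues graph.
   Context: A cycle $v_0v_1\cdots v_{k-1}v_0$ is consistent if some automorphism $\gamma$ of $\Gamma$ satisfies $\gamma(v_i)=v_{i+1}$ for all $i$ (indices mod $k$). A $3$-arc is a sequence of vertices $x_0x_1x_2x_3$ with $x_ix_{i+1}$ edges and $x_i\neq x_{i+2}$. The girth is the length of a shortest cycle. -}

module Defs where

open import Data.Nat using (ℕ; zero; suc; _+_; _≤_; _<_; _%_; _≡ᵇ_)
open import Data.Nat.DivMod using (m%n<n)
open import Data.Empty using (⊥)
open import Data.Bool using (Bool; true; false; _∨_; T)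
open import Data.List using (List; []; _∷_; length)
open import Data.Fin using (Fin; toℕ; fromℕ<)
open import Data.Product using (Σ; ∃; _×_; _,_)
open import Relation.Binary.PropositionalEquality using (_≡_; _≢_)
open import Relation.Nullary using (¬_)
open import Function.Definitions using (Injective)

record Graph : Set₁ where
  field
    V   : Set
    Adj : V → V → Set
open Graph public

IsSimple : Graph → Set
IsSimple Γ = (∀ u v → Adj Γ u v → Adj Γ v u) × (∀ v → ¬ Adj Γ v v)

Cubic : Graph → Set
Cubic Γ = ∀ v → Σ (Fin 3 → V Γ) λ nb →
            Injective _≡_ _≡_ nb
          × (∀ i → Adj Γ v (nb i))
          × (∀ w → Adj Γ v w → ∃ λ i → nb i ≡ w)

data Walk (Γ : Graph) : V Γ → V Γ → Set where
  here : ∀ {u} → Walk Γ u u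
  step : ∀ {u v w} → Adj Γ u v → Walk Γ v w → Walk Γ u w

Connected : Graph → Set
Connected Γ = ∀ u v → Walk Γ u v

record Automorphism (Γ : Graph) : Set where
  field
    fun      : V Γ → V Γ
    inv      : V Γ → V Γ
    inv-fun  : ∀ v → inv (fun v) ≡ v
    fun-inv  : ∀ v → fun (inv v) ≡ v
    pres     : ∀ u v → Adj Γ u v → Adj Γ (fun u) (fun v)
    refl'    : ∀ u v → Adj Γ (fun u) (fun v) → Adj Γ u v
open Automorphism public

record Iso (Γ Δ : Graph) : Set where
  field
    to       : V Γ → V Δ
    from     : V Δ → V Γ
    from-to  : ∀ v → from (to v) ≡ v
    to-from  : ∀ w → to (from w) ≡ w
    pres     : ∀ u v → Adj Γ u v → Adj Δ (to u) (to v)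
    refl'    : ∀ u v → Adj Δ (to u) (to v) → Adj Γ u v

-- Cycles.  Indices of a cycle of length suc m live in Fin (suc m),
-- with successor taken mod (suc m).

next : ∀ {m} → Fin (suc m) → Fin (suc m)
next {m} i = fromℕ< (m%n<n (suc (toℕ i)) (suc m))

record Cycle (Γ : Graph) (m : ℕ) : Set where
  field
    vert  : Fin (suc m) → V Γ
    inj   : Injective _≡_ _≡_ vert
    adj   : ∀ i → Adj Γ (vert i) (vert (next i))
open Cycle public

HasCycleOfLength : Graph → ℕ → Set
HasCycleOfLength Γ zero    = ⊥
HasCycleOfLength Γ (suc m) = Cycle Γ m

Girth : Graph → ℕ → Set
Girth Γ g = HasCycleOfLength Γ g × (∀ k → 3 ≤ k → k < g → ¬ HasCycleOfLength Γ k)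

Consistent : ∀ {Γ m} → Cycle Γ m → Set
Consistent {Γ} C = Σ (Automorphism Γ) λ γ → ∀ i → fun γ (vert C i) ≡ vert C (next i)

record ThreeArc (Γ : Graph) : Set where
  field
    x₀ x₁ x₂ x₃ : V Γ
    a₀₁ : Adj Γ x₀ x₁
    a₁₂ : Adj Γ x₁ x₂
    a₂₃ : Adj Γ x₂ x₃
    d₀₂ : x₀ ≢ x₂
    d₁₃ : x₁ ≢ x₃
open ThreeArc public

ArcOnCycle : ∀ {Γ} → ThreeArc Γ → Cycle Γ 5 → Set
ArcOnCycle A C = ∃ λ i → vert C i ≡ x₀ A × vert C (next i) ≡ x₁ A
                        × vert C (next (next i)) ≡ x₂ A
                        × vert C (next (next (next i))) ≡ x₃ A

-- The Heawood, Pappus and Desargues graphs, via their LCF notations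
--   Heawood   [5,-5]^7            on 14 vertices
--   Pappus    [5,7,-7,7,-7,-5]^3  on 18 vertices
--   Desargues [5,-5,9,-9]^5       on 20 vertices
-- (negative offsets written mod n).  Vertex i is adjacent to i ± 1 and to
-- i + a_{i mod k} (mod n).

nth : List ℕ → ℕ → ℕ
nth []       _       = 0
nth (x ∷ xs) zero    = x
nth (x ∷ xs) (suc i) = nth xs i

lcfEdge : (n : ℕ) → List ℕ → ℕ → ℕ → Bool
lcfEdge zero    offs i j = false
lcfEdge (suc n) offs i j =
      (j ≡ᵇ (suc i % suc n))
    ∨ (i ≡ᵇ (suc j % suc n))
    ∨ (j ≡ᵇ ((i + off i) % suc n))
    ∨ (i ≡ᵇ ((j + off j) % suc n))
  where
    off : ℕ → ℕ
    off x with length offs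
    ... | zero  = 0
    ... | suc k = nth offs (x % suc k)

LCF : (n : ℕ) → List ℕ → Graph
LCF n offs = record { V = Fin n ; Adj = λ i j → T (lcfEdge n offs (toℕ i) (toℕ j)) }

Heawood : Graph
Heawood = LCF 14 (5 ∷ 9 ∷ [])

Pappus : Graph
Pappus = LCF 18 (5 ∷ 7 ∷ 11 ∷ 7 ∷ 11 ∷ 13 ∷ [])

Desargues : Graph
Desargues = LCF 20 (5 ∷ 15 ∷ 9 ∷ 11 ∷ [])

{-# OPTIONS --safe #-}

-- Let γ rotate the consistent hexagon, so that its vertices are c k = γᵏ c₀, and let d₀ be the
-- third neighbour of c₀.  As γ⁶ fixes c₀ and both its hexagon neighbours it fixes d₀, and in the
-- same way every vertex constructed later has period dividing 6.  Closing a few well-chosen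
-- 3-arcs to hexagons and using girth 6 determines the neighbourhoods of d₀ and of at most two
-- further vertices, in one of three ways.  Each way describes Γ by a voltage graph over ⟨γ⟩ with
-- at most four orbits, and this description gives a map from the LCF model of the Heawood,
-- Pappus or Desargues graph to Γ that is a local isomorphism.  It is onto since Γ is connected,
-- and one-to-one since any two model vertices are joined by a non-backtracking walk of length
-- at most 5, whose image would otherwise close a cycle shorter than the girth.

module Submission where

open import Defs
open import Data.Empty using (⊥; ⊥-elim)
open import Data.Fin using (Fin; zero; suc; toℕ; fromℕ<; #_)
open import Data.Fin.Properties using (_≟_; any?; all?; <⇒notInjective; toℕ<n; toℕ-fromℕ<)
open import Data.List using (List; []; _∷_; length)
open import Data.Nat as ℕ using (ℕ; zero; suc; _+_; _*_; _%_; _/_; NonZero)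
open import Data.Nat.DivMod using (m%n<n; m≡m%n+[m/n]*n)
open import Data.Nat.GeneralisedArithmetic using (fold; fold-+)
open import Data.Nat.Properties using (+-comm; ≤-refl; m≤m+n; +-monoʳ-<)
open import Data.Product using (Σ; ∃; ∃₂; _×_; _,_; proj₁; proj₂)
open import Data.Sum using (_⊎_; inj₁; inj₂)
open import Data.Vec using (Vec; []; _∷_; lookup)
open import Data.Vec.Properties using (lookup∘tabulate)
open import Data.Vec.Relation.Unary.All using ([]; _∷_)
open import Data.Vec.Relation.Unary.AllPairs using ([]; _∷_)
open import Data.Vec.Relation.Unary.Unique.Propositional using (Unique)
open import Data.Vec.Relation.Unary.Unique.Propositional.Properties using (lookup-injective)
open import Function using (_∘_)
open import Relation.Binary.PropositionalEquality
  using (_≡_; _≢_; refl; sym; trans; cong; subst; subst₂; ≢-sym; module ≡-Reasoning)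
open import Relation.Nullary using (¬_; Dec; yes; no; ¬?)
open import Relation.Nullary.Decidable
  using (_×-dec_; _⊎-dec_; _→-dec_; map′; True; toWitness; from-yes; T?)

Fin3-noFourDistinct : {i j k l : Fin 3} → Unique (i ∷ j ∷ k ∷ l ∷ []) → ⊥
Fin3-noFourDistinct u = <⇒notInjective ≤-refl (λ {a} {b} → lookup-injective u a b)

Fin3-avoid : (i j : Fin 3) → ∃ λ k → k ≢ i × k ≢ j
Fin3-avoid zero             zero             = # 1 , (λ ()) , (λ ())
Fin3-avoid zero             (suc zero)       = # 2 , (λ ()) , (λ ())
Fin3-avoid zero             (suc (suc zero)) = # 1 , (λ ()) , (λ ())
Fin3-avoid (suc zero)       zero             = # 2 , (λ ()) , (λ ())
Fin3-avoid (suc zero)       (suc zero)       = # 0 , (λ ()) , (λ ())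
Fin3-avoid (suc zero)       (suc (suc zero)) = # 0 , (λ ()) , (λ ())
Fin3-avoid (suc (suc zero)) zero             = # 1 , (λ ()) , (λ ())
Fin3-avoid (suc (suc zero)) (suc zero)       = # 0 , (λ ()) , (λ ())
Fin3-avoid (suc (suc zero)) (suc (suc zero)) = # 0 , (λ ()) , (λ ())

next^ : ℕ → Fin 6 → Fin 6
next^ k i = fold i next k

next^6 : ∀ i → next^ 6 i ≡ i
next^6 = from-yes (all? λ i → next^ 6 i ≟ i)

next^-injective : ∀ i (a b : Fin 6) → next^ (toℕ a) i ≡ next^ (toℕ b) i → a ≡ b
next^-injective = from-yes (all? λ i → all? λ (a : Fin 6) → all? λ b →
                             (next^ (toℕ a) i ≟ next^ (toℕ b) i) →-dec (a ≟ b))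

module Adjacency (Γ : Graph) where

  infix 4 _~_ _≁_

  _~_ : V Γ → V Γ → Set
  _~_ = Adj Γ

  _≁_ : V Γ → V Γ → Set
  x ≁ y = ¬ x ~ y

  ~-respˡ : ∀ {x y z} → x ≡ y → x ~ z → y ~ z
  ~-respˡ refl x~z = x~z

  ~-respʳ : ∀ {x y z} → y ≡ z → x ~ y → x ~ z
  ~-respʳ refl x~y = x~y

  record Neighbours (x a b c : V Γ) : Set where
    field
      x~a : x ~ a
      x~b : x ~ b
      x~c : x ~ c
      a≢b : a ≢ b
      a≢c : a ≢ c
      b≢c : b ≢ c

    unique : Unique (a ∷ b ∷ c ∷ [])
    unique = (a≢b ∷ a≢c ∷ []) ∷ (b≢c ∷ []) ∷ [] ∷ []

    adjacent : ∀ i → x ~ lookup (a ∷ b ∷ c ∷ []) i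
    adjacent zero             = x~a
    adjacent (suc zero)       = x~b
    adjacent (suc (suc zero)) = x~c

module SimpleGraph (Γ : Graph) (simple : IsSimple Γ) where

  open Adjacency Γ

  ~-sym : ∀ {x y} → x ~ y → y ~ x
  ~-sym = proj₁ simple _ _

  ~⇒≢ : ∀ {x y} → x ~ y → x ≢ y
  ~⇒≢ {x} x~x refl = proj₂ simple x x~x

module CubicGraph (Γ : Graph) (cubic : Cubic Γ) where

  open Adjacency Γ

  private
    nb : V Γ → Fin 3 → V Γ
    nb x = proj₁ (cubic x)

    nb-adjacent : ∀ x i → x ~ nb x i
    nb-adjacent x = proj₁ (proj₂ (proj₂ (cubic x)))

    index : ∀ {x w} → x ~ w → Fin 3
    index {x} {w} x~w = proj₁ (proj₂ (proj₂ (proj₂ (cubic x))) w x~w)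

    nb-index : ∀ {x w} (x~w : x ~ w) → nb x (index x~w) ≡ w
    nb-index {x} {w} x~w = proj₂ (proj₂ (proj₂ (proj₂ (cubic x))) w x~w)

    index-unique : ∀ {x w i} (x~w : x ~ w) → nb x i ≡ w → i ≡ index x~w
    index-unique {x} x~w e = proj₁ (proj₂ (cubic x)) (trans e (sym (nb-index x~w)))

    index-≡ : ∀ {x u v} (p : x ~ u) (q : x ~ v) → index p ≡ index q → u ≡ v
    index-≡ {x} p q e = trans (sym (nb-index p)) (trans (cong (nb x) e) (nb-index q))

    index-≢ : ∀ {x u v} (p : x ~ u) (q : x ~ v) → u ≢ v → index p ≢ index q
    index-≢ p q u≢v = u≢v ∘ index-≡ p q

  neighbour-≟ : ∀ {x u v} → x ~ u → x ~ v → Dec (u ≡ v)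
  neighbour-≟ p q with index p ≟ index q
  ... | yes e = yes (index-≡ p q e)
  ... | no ne = no λ { refl → ne (index-unique q (nb-index p)) }

  exhaust : ∀ {x a b c w} → Neighbours x a b c → x ~ w → w ≡ a ⊎ w ≡ b ⊎ w ≡ c
  exhaust N x~w with neighbour-≟ x~w x~a | neighbour-≟ x~w x~b | neighbour-≟ x~w x~c
    where open Neighbours N
  ... | yes w≡a | _       | _       = inj₁ w≡a
  ... | no _    | yes w≡b | _       = inj₂ (inj₁ w≡b)
  ... | no _    | no _    | yes w≡c = inj₂ (inj₂ w≡c)
  ... | no w≢a  | no w≢b  | no w≢c  = ⊥-elim (Fin3-noFourDistinct
        ( (index-≢ x~w x~a w≢a ∷ index-≢ x~w x~b w≢b ∷ index-≢ x~w x~c w≢c ∷ [])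
        ∷ (index-≢ x~a x~b a≢b ∷ index-≢ x~a x~c a≢c ∷ [])
        ∷ (index-≢ x~b x~c b≢c ∷ []) ∷ [] ∷ []))
    where open Neighbours N

  third-neighbour : ∀ {x a b} → x ~ a → x ~ b → a ≢ b → Σ (V Γ) (Neighbours x a b)
  third-neighbour {x} x~a x~b a≢b with Fin3-avoid (index x~a) (index x~b)
  ... | k , k≢ia , k≢ib = nb x k , record
    { x~a = x~a ; x~b = x~b ; x~c = nb-adjacent x k ; a≢b = a≢b
    ; a≢c = k≢ia ∘ index-unique x~a ∘ sym ; b≢c = k≢ib ∘ index-unique x~b ∘ sym }

  fixes-third : (σ : V Γ → V Γ) → (∀ {u v} → u ~ v → σ u ~ σ v) → (∀ {u v} → σ u ≡ σ v → u ≡ v) →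
                ∀ {x a b c} → Neighbours x a b c → σ x ≡ x → σ a ≡ a → σ b ≡ b → σ c ≡ c
  fixes-third σ σ-adjacent σ-injective N σx≡x σa≡a σb≡b
    with exhaust N (~-respˡ σx≡x (σ-adjacent (Neighbours.x~c N)))
  ... | inj₁ σc≡a        = ⊥-elim (Neighbours.a≢c N (sym (σ-injective (trans σc≡a (sym σa≡a)))))
  ... | inj₂ (inj₁ σc≡b) = ⊥-elim (Neighbours.b≢c N (sym (σ-injective (trans σc≡b (sym σb≡b)))))
  ... | inj₂ (inj₂ σc≡c) = σc≡c

module Girth6 (Γ : Graph) (simple : IsSimple Γ) (girth : Girth Γ 6) where

  open Adjacency Γ
  open SimpleGraph Γ simple

  private
    cycle : ∀ {m} (vs : Vec (V Γ) (suc m)) → Unique vs →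
            (∀ i → lookup vs i ~ lookup vs (next i)) → Cycle Γ m
    cycle vs u closed = record
      { vert = lookup vs ; inj = λ {i} {j} → lookup-injective u i j ; adj = closed }

    no-short-cycle : (k : Fin 3) → ¬ Cycle Γ (2 + toℕ k)
    no-short-cycle k = proj₂ girth (3 + toℕ k) (m≤m+n 3 (toℕ k)) (+-monoʳ-< 3 (toℕ<n k))

  no-triangle : ∀ {a b c} → a ~ b → b ~ c → c ~ a → ⊥
  no-triangle a~b b~c c~a = no-short-cycle (# 0) (cycle (_ ∷ _ ∷ _ ∷ [])
    ((~⇒≢ a~b ∷ ≢-sym (~⇒≢ c~a) ∷ []) ∷ (~⇒≢ b~c ∷ []) ∷ [] ∷ [])
    λ { zero → a~b ; (suc zero) → b~c ; (suc (suc zero)) → c~a })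

  no-quadrangle : ∀ {a b c d} → a ~ b → b ~ c → c ~ d → d ~ a → a ≢ c → b ≢ d → ⊥
  no-quadrangle a~b b~c c~d d~a a≢c b≢d = no-short-cycle (# 1) (cycle (_ ∷ _ ∷ _ ∷ _ ∷ [])
    ( (~⇒≢ a~b ∷ a≢c ∷ ≢-sym (~⇒≢ d~a) ∷ []) ∷ (~⇒≢ b~c ∷ b≢d ∷ []) ∷ (~⇒≢ c~d ∷ []) ∷ [] ∷ [])
    λ { zero → a~b ; (suc zero) → b~c ; (suc (suc zero)) → c~d ; (suc (suc (suc zero))) → d~a })

  no-pentagon : ∀ {a b c d e} → a ~ b → b ~ c → c ~ d → d ~ e → e ~ a → ⊥
  no-pentagon {a} {b} {c} {d} {e} a~b b~c c~d d~e e~a = no-short-cycle (# 2)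
    (cycle (a ∷ b ∷ c ∷ d ∷ e ∷ [])
      ( (~⇒≢ a~b ∷ a≢c ∷ a≢d ∷ ≢-sym (~⇒≢ e~a) ∷ [])
      ∷ (~⇒≢ b~c ∷ b≢d ∷ b≢e ∷ []) ∷ (~⇒≢ c~d ∷ c≢e ∷ []) ∷ (~⇒≢ d~e ∷ []) ∷ [] ∷ [])
      λ { zero → a~b ; (suc zero) → b~c ; (suc (suc zero)) → c~d
        ; (suc (suc (suc zero))) → d~e ; (suc (suc (suc (suc zero)))) → e~a })
    where
    a≢c : a ≢ c
    a≢c refl = no-triangle c~d d~e e~a
    a≢d : a ≢ d
    a≢d refl = no-triangle a~b b~c c~d
    b≢d : b ≢ d
    b≢d refl = no-triangle d~e e~a a~b
    b≢e : b ≢ e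
    b≢e refl = no-triangle b~c c~d d~e
    c≢e : c ≢ e
    c≢e refl = no-triangle e~a a~b b~c

infixr 8 _^_

_^_ : ∀ {Γ} → Automorphism Γ → ℕ → V Γ → V Γ
(γ ^ k) x = fold x (fun γ) k

module Powers {Γ : Graph} (γ : Automorphism Γ) where

  open Adjacency Γ

  ^-+ : ∀ a b x → (γ ^ (a + b)) x ≡ (γ ^ a) ((γ ^ b) x)
  ^-+ a b x = fold-+ x (fun γ) a

  ^-adjacent : ∀ k {x y} → x ~ y → (γ ^ k) x ~ (γ ^ k) y
  ^-adjacent zero    x~y = x~y
  ^-adjacent (suc k) x~y = pres γ _ _ (^-adjacent k x~y)

  ^-injective : ∀ k {x y} → (γ ^ k) x ≡ (γ ^ k) y → x ≡ y
  ^-injective zero    e = e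
  ^-injective (suc k) {x} {y} e = ^-injective k (begin
    (γ ^ k) x                    ≡⟨ sym (inv-fun γ _) ⟩
    inv γ ((γ ^ suc k) x)        ≡⟨ cong (inv γ) e ⟩
    inv γ ((γ ^ suc k) y)        ≡⟨ inv-fun γ _ ⟩
    (γ ^ k) y                    ∎)
    where open ≡-Reasoning

  ^-* : ∀ p {x} → (γ ^ p) x ≡ x → ∀ q → (γ ^ (q * p)) x ≡ x
  ^-* p e zero    = refl
  ^-* p {x} e (suc q) = trans (^-+ p (q * p) x) (trans (cong (γ ^ p) (^-* p e q)) e)

  ^-% : ∀ p .{{_ : NonZero p}} {x} → (γ ^ p) x ≡ x → ∀ a → (γ ^ a) x ≡ (γ ^ (a % p)) x
  ^-% p {x} e a = begin
    (γ ^ a) x                               ≡⟨ cong (λ b → (γ ^ b) x) (m≡m%n+[m/n]*n a p) ⟩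
    (γ ^ (a % p + (a / p) * p)) x           ≡⟨ ^-+ (a % p) _ x ⟩
    (γ ^ (a % p)) ((γ ^ ((a / p) * p)) x)   ≡⟨ cong (γ ^ (a % p)) (^-* p e (a / p)) ⟩
    (γ ^ (a % p)) x                         ∎
    where open ≡-Reasoning

  -- Exponents are reduced mod p so that the shifted statements compute for literal arguments:
  -- shift-~ 5 0 1 turns x ~ γ¹ y into γ⁵ x ~ y.
  module Modulo (p : ℕ) .{{_ : NonZero p}} where

    Periodic : V Γ → Set
    Periodic x = (γ ^ p) x ≡ x

    periodic-^ : ∀ k {x} → Periodic x → Periodic ((γ ^ k) x)
    periodic-^ k {x} e = begin
      (γ ^ p) ((γ ^ k) x)   ≡⟨ sym (^-+ p k x) ⟩
      (γ ^ (p + k)) x       ≡⟨ cong (λ b → (γ ^ b) x) (+-comm p k) ⟩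
      (γ ^ (k + p)) x       ≡⟨ ^-+ k p x ⟩
      (γ ^ k) ((γ ^ p) x)   ≡⟨ cong (γ ^ k) e ⟩
      (γ ^ k) x             ∎
      where open ≡-Reasoning

    private
      reduce : ∀ {x} → Periodic x → ∀ k a → (γ ^ k) ((γ ^ a) x) ≡ (γ ^ ((k + a) % p)) x
      reduce {x} e k a = trans (sym (^-+ k a x)) (^-% p e (k + a))

    shift-≡ : ∀ k a b {x y} → Periodic x → Periodic y →
              (γ ^ a) x ≡ (γ ^ b) y → (γ ^ ((k + a) % p)) x ≡ (γ ^ ((k + b) % p)) y
    shift-≡ k a b px py e = trans (sym (reduce px k a)) (trans (cong (γ ^ k) e) (reduce py k b))

    shift-≢ : ∀ k a b {x y} → Periodic x → Periodic y →
              (γ ^ a) x ≢ (γ ^ b) y → (γ ^ ((k + a) % p)) x ≢ (γ ^ ((k + b) % p)) y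
    shift-≢ k a b px py ne e =
      ne (^-injective k (trans (reduce px k a) (trans e (sym (reduce py k b)))))

    shift-~ : ∀ k a b {x y} → Periodic x → Periodic y →
              (γ ^ a) x ~ (γ ^ b) y → (γ ^ ((k + a) % p)) x ~ (γ ^ ((k + b) % p)) y
    shift-~ k a b px py x~y = subst₂ _~_ (reduce px k a) (reduce py k b) (^-adjacent k x~y)

    all-translates : ∀ {x} (P : V Γ → Set) → Periodic x →
                     (∀ (j : Fin p) → P ((γ ^ toℕ j) x)) → ∀ k → P ((γ ^ k) x)
    all-translates {x} P px P-fin k = subst P
      (trans (cong (λ a → (γ ^ a) x) (toℕ-fromℕ< (m%n<n k p))) (sym (^-% p px k)))
      (P-fin (fromℕ< (m%n<n k p)))

    shift-Neighbours : ∀ k ex ea eb ec {x a b c} →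
      Periodic x → Periodic a → Periodic b → Periodic c →
      Neighbours ((γ ^ ex) x) ((γ ^ ea) a) ((γ ^ eb) b) ((γ ^ ec) c) →
      Neighbours ((γ ^ ((k + ex) % p)) x) ((γ ^ ((k + ea) % p)) a)
                 ((γ ^ ((k + eb) % p)) b) ((γ ^ ((k + ec) % p)) c)
    shift-Neighbours k ex ea eb ec px pa pb pc N = record
      { x~a = shift-~ k ex ea px pa x~a ; x~b = shift-~ k ex eb px pb x~b
      ; x~c = shift-~ k ex ec px pc x~c
      ; a≢b = shift-≢ k ea eb pa pb a≢b ; a≢c = shift-≢ k ea ec pa pc a≢c
      ; b≢c = shift-≢ k eb ec pb pc b≢c }
      where open Neighbours N

-- Covering a cubic graph of girth 6 by a finite model

module NeighbourFunction {n : ℕ} (nb : Fin n → Fin 3 → Fin n) where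

  -- NBWalk ℓ p a b: a walk of length ℓ from a to b that never steps straight back, p being the
  -- vertex visited just before a.
  NBWalk : ℕ → Fin n → Fin n → Fin n → Set
  NBWalk zero    p a b = a ≡ b
  NBWalk (suc ℓ) p a b = ∃ λ i → nb a i ≢ p × NBWalk ℓ a (nb a i) b

  Near : Fin n → Fin n → Set
  Near a b = ∃₂ λ (ℓ : Fin 5) i → NBWalk (toℕ ℓ) a (nb a i) b

  nbWalk? : ∀ ℓ p a b → Dec (NBWalk ℓ p a b)
  nbWalk? zero    p a b = a ≟ b
  nbWalk? (suc ℓ) p a b = any? λ i → ¬? (nb a i ≟ p) ×-dec nbWalk? ℓ a (nb a i) b

  near? : ∀ a b → Dec (Near a b)
  near? a b = any? λ ℓ → any? λ i → nbWalk? (toℕ ℓ) a (nb a i) b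

  record Describes (E : Fin n → Fin n → Set) : Set where
    field
      nb-adjacent : ∀ k i → E k (nb k i)
      adjacent-nb : ∀ k l → E k l → ∃ λ i → nb k i ≡ l
      symmetric   : ∀ k l → E k l → E l k
      near        : ∀ a b → a ≡ b ⊎ Near a b

  describes? : ∀ {E} → (∀ k l → Dec (E k l)) → Dec (Describes E)
  describes? E? = map′
    (λ (p , q , r , s) → record { nb-adjacent = p ; adjacent-nb = q ; symmetric = r ; near = s })
    (λ D → let open Describes D in nb-adjacent , adjacent-nb , symmetric , near)
    (    (all? λ k → all? λ i → E? k (nb k i))
    ×-dec (all? λ k → all? λ l → E? k l →-dec any? λ i → nb k i ≟ l)
    ×-dec (all? λ k → all? λ l → E? k l →-dec E? l k)
    ×-dec (all? λ a → all? λ b → (a ≟ b) ⊎-dec near? a b))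

module Cover (Γ : Graph) (simple : IsSimple Γ) (cubic : Cubic Γ) (girth : Girth Γ 6)
  (connected : Connected Γ) {m : ℕ} {E : Fin (suc m) → Fin (suc m) → Set}
  {nb : Fin (suc m) → Fin 3 → Fin (suc m)} (D : NeighbourFunction.Describes nb E)
  (φ : Fin (suc m) → V Γ) (φ-adjacent : ∀ k i → Adj Γ (φ k) (φ (nb k i)))
  (φ-locallyInjective : ∀ k {i j} → φ (nb k i) ≡ φ (nb k j) → i ≡ j) where

  open Adjacency Γ
  open SimpleGraph Γ simple
  open CubicGraph Γ cubic
  open Girth6 Γ simple girth
  open NeighbourFunction nb
  open Describes D

  φ-nonBacktracking : ∀ a i j → nb (nb a i) j ≢ a → φ (nb (nb a i) j) ≢ φ a
  φ-nonBacktracking a i j x₂≢a φx₂≡φa with adjacent-nb (nb a i) a (symmetric a _ (nb-adjacent a i))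
  ... | j′ , x₁→a = x₂≢a (trans (cong (nb _) j≡j′) x₁→a)
    where
    j≡j′ : j ≡ j′
    j≡j′ = φ-locallyInjective _ (trans φx₂≡φa (cong φ (sym x₁→a)))

  -- The image of a closed non-backtracking walk of length at most 5 would contain a cycle
  -- shorter than the girth.
  φ-separates : ∀ {a b} → Near a b → φ a ≢ φ b
  φ-separates {a} (zero , i , refl) = ~⇒≢ (φ-adjacent a i)
  φ-separates {a} (suc zero , i , j , x₂≢a , refl) = ≢-sym (φ-nonBacktracking a i j x₂≢a)
  φ-separates {a} (suc (suc zero) , i , j , _ , k , _ , refl) φa≡φb =
    no-triangle (φ-adjacent a i) (φ-adjacent _ j) (~-respʳ (sym φa≡φb) (φ-adjacent _ k))
  φ-separates {a} (suc (suc (suc zero)) , i , j , x₂≢a , k , x₃≢x₁ , l , _ , refl) φa≡φb =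
    no-quadrangle (φ-adjacent a i) (φ-adjacent _ j) (φ-adjacent _ k)
      (~-respʳ (sym φa≡φb) (φ-adjacent _ l))
      (φ-separates (# 1 , i , j , x₂≢a , refl)) (φ-separates (# 1 , j , k , x₃≢x₁ , refl))
  φ-separates {a} (suc (suc (suc (suc zero))) , i , j , _ , k , _ , l , _ , o , _ , refl) φa≡φb =
    no-pentagon (φ-adjacent a i) (φ-adjacent _ j) (φ-adjacent _ k) (φ-adjacent _ l)
      (~-respʳ (sym φa≡φb) (φ-adjacent _ o))

  φ-injective : ∀ {a b} → φ a ≡ φ b → a ≡ b
  φ-injective {a} {b} φa≡φb with near a b
  ... | inj₁ a≡b = a≡b
  ... | inj₂ a-b = ⊥-elim (φ-separates a-b φa≡φb)

  φ-neighbour : ∀ k {w} → φ k ~ w → ∃ λ i → φ (nb k i) ≡ w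
  φ-neighbour k φk~w with exhaust N (φk~w)
    where
    N : Neighbours (φ k) (φ (nb k (# 0))) (φ (nb k (# 1))) (φ (nb k (# 2)))
    N = record
      { x~a = φ-adjacent k _ ; x~b = φ-adjacent k _ ; x~c = φ-adjacent k _
      ; a≢b = (λ ()) ∘ φ-locallyInjective k ; a≢c = (λ ()) ∘ φ-locallyInjective k
      ; b≢c = (λ ()) ∘ φ-locallyInjective k }
  ... | inj₁ w≡x        = # 0 , sym w≡x
  ... | inj₂ (inj₁ w≡x) = # 1 , sym w≡x
  ... | inj₂ (inj₂ w≡x) = # 2 , sym w≡x

  lift : ∀ k {v} → Walk Γ (φ k) v → ∃ λ l → φ l ≡ v
  lift k here = k , refl
  lift k (step φk~u walk) with φ-neighbour k φk~u
  ... | i , refl = lift (nb k i) walk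

  φ-surjective : ∀ v → ∃ λ k → φ k ≡ v
  φ-surjective v = lift zero (connected (φ zero) v)

  isomorphism : Iso Γ (record { V = Fin (suc m) ; Adj = E })
  isomorphism = record
    { to      = to
    ; from    = φ
    ; from-to = φ-to
    ; to-from = λ k → φ-injective (φ-to (φ k))
    ; pres    = λ u v u~v → preserves (subst₂ _~_ (sym (φ-to u)) (sym (φ-to v)) u~v)
    ; refl'   = λ u v e → reflects e
    }
    where
    to : V Γ → Fin (suc m)
    to v = proj₁ (φ-surjective v)
    φ-to : ∀ v → φ (to v) ≡ v
    φ-to v = proj₂ (φ-surjective v)
    preserves : ∀ {k l} → φ k ~ φ l → E k l
    preserves {k} φk~φl with φ-neighbour k φk~φl
    ... | i , φnb≡φl = subst (E k) (φ-injective φnb≡φl) (nb-adjacent k i)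
    reflects : ∀ {u v} → E (to u) (to v) → u ~ v
    reflects {u} {v} e with adjacent-nb _ _ e
    ... | i , nb≡ = subst₂ _~_ (φ-to u) (trans (cong φ nb≡) (φ-to v)) (φ-adjacent _ i)

-- Voltage descriptions

-- The representative of orbit r has period `period r` under γ, and dart r j = (t , v) says
-- that the j-th neighbour of that representative is γᵛ applied to the representative of t.
record VoltageGraph : Set where
  field
    orbits         : ℕ
    period         : Fin orbits → ℕ
    period-nonZero : ∀ r → NonZero (period r)
    dart           : Fin orbits → Fin 3 → Fin orbits × ℕ

  target : Fin orbits → Fin 3 → Fin orbits
  target r j = proj₁ (dart r j)

  voltage : Fin orbits → Fin 3 → ℕ
  voltage r j = proj₂ (dart r j)

  _mod_ : ℕ → Fin orbits → ℕ
  a mod r = (a % period r) {{period-nonZero r}}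

module Labelling (X : VoltageGraph) {n : ℕ} (nb : Fin n → Fin 3 → Fin n)
  (orbit : Fin n → Fin (VoltageGraph.orbits X)) (shift : Fin n → ℕ) where

  open VoltageGraph X

  -- Model vertex k stands for γ^(shift k) applied to the representative of orbit k; Matches k i j
  -- says that its i-th model neighbour then stands for the γ^(shift k)-image of dart j.
  Matches : Fin n → Fin 3 → Fin 3 → Set
  Matches k i j = target (orbit k) j ≡ orbit (nb k i)
                × (shift k + voltage (orbit k) j) mod target (orbit k) j
                  ≡ shift (nb k i) mod target (orbit k) j

  matches? : ∀ k i j → Dec (Matches k i j)
  matches? k i j = (target (orbit k) j ≟ orbit (nb k i)) ×-dec (_ ℕ.≟ _)

  record Compatible : Set where
    field
      matched     : ∀ k i → ∃ (Matches k i)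
      unambiguous : ∀ k i i′ j → Matches k i j → Matches k i′ j → i ≡ i′

  compatible? : Dec Compatible
  compatible? = map′
    (λ (p , q) → record { matched = p ; unambiguous = q })
    (λ C → Compatible.matched C , Compatible.unambiguous C)
    (    (all? λ k → all? λ i → any? λ j → matches? k i j)
    ×-dec (all? λ k → all? λ i → all? λ i′ → all? λ j →
             matches? k i j →-dec matches? k i′ j →-dec (i ≟ i′)))

record Certificate (m : ℕ) (E : Fin (suc m) → Fin (suc m) → Set) : Set where
  field
    nb         : Fin (suc m) → Fin 3 → Fin (suc m)
    describes  : NeighbourFunction.Describes nb E
    voltages   : VoltageGraph
    orbit      : Fin (suc m) → Fin (VoltageGraph.orbits voltages)
    shift      : Fin (suc m) → ℕ
    compatible : Labelling.Compatible voltages nb orbit shift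

module Realisations {Γ : Graph} (γ : Automorphism Γ) (X : VoltageGraph) where

  open Adjacency Γ
  open VoltageGraph X

  dartEnd : (Fin orbits → V Γ) → Fin orbits → Fin 3 → V Γ
  dartEnd rep r j = (γ ^ voltage r j) (rep (target r j))

  record Realisation : Set where
    field
      rep        : Fin orbits → V Γ
      periodic   : ∀ r → (γ ^ period r) (rep r) ≡ rep r
      neighbours : ∀ r → Neighbours (rep r) (dartEnd rep r (# 0)) (dartEnd rep r (# 1))
                                            (dartEnd rep r (# 2))

    dartEnd-adjacent : ∀ r j → rep r ~ dartEnd rep r j
    dartEnd-adjacent r j =
      ~-respʳ (lookup∘tabulate (dartEnd rep r) j) (Neighbours.adjacent (neighbours r) j)

    dartEnd-injective : ∀ r {j j′} → dartEnd rep r j ≡ dartEnd rep r j′ → j ≡ j′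
    dartEnd-injective r {j} {j′} e = lookup-injective (Neighbours.unique (neighbours r)) j j′
      (trans (lookup∘tabulate (dartEnd rep r) j)
        (trans e (sym (lookup∘tabulate (dartEnd rep r) j′))))

module Certified (Γ : Graph) (simple : IsSimple Γ) (cubic : Cubic Γ) (girth : Girth Γ 6)
  (connected : Connected Γ) (γ : Automorphism Γ) where

  open Adjacency Γ
  open Powers γ

  certified-iso : ∀ {m E} (C : Certificate m E) →
                  Realisations.Realisation γ (Certificate.voltages C) →
                  Iso Γ (record { V = Fin (suc m) ; Adj = E })
  certified-iso {m} C R =
    Cover.isomorphism Γ simple cubic girth connected describes φ φ-adjacent φ-locallyInjective
    where
    open Certificate C
    open VoltageGraph voltages
    open Labelling voltages nb orbit shift
    open Realisations γ voltages
    open Realisation R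

    φ : Fin (suc m) → V Γ
    φ k = (γ ^ shift k) (rep (orbit k))

    φ-nb : ∀ k i j → Matches k i j → φ (nb k i) ≡ (γ ^ shift k) (dartEnd rep (orbit k) j)
    φ-nb k i j (t≡ , s≡) = begin
      (γ ^ shift l) (rep (orbit l))        ≡⟨ cong (λ r → (γ ^ shift l) (rep r)) (sym t≡) ⟩
      (γ ^ shift l) (rep t)                ≡⟨ reduce (shift l) ⟩
      (γ ^ (shift l mod t)) (rep t)        ≡⟨ cong (λ a → (γ ^ a) (rep t)) (sym s≡) ⟩
      (γ ^ ((shift k + v) mod t)) (rep t)  ≡⟨ sym (reduce (shift k + v)) ⟩
      (γ ^ (shift k + v)) (rep t)          ≡⟨ ^-+ (shift k) v (rep t) ⟩
      (γ ^ shift k) ((γ ^ v) (rep t))      ∎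
      where
      open ≡-Reasoning
      l : Fin (suc m)
      l = nb k i
      t : Fin orbits
      t = target (orbit k) j
      v : ℕ
      v = voltage (orbit k) j
      reduce : ∀ a → (γ ^ a) (rep t) ≡ (γ ^ (a mod t)) (rep t)
      reduce = ^-% (period t) {{period-nonZero t}} (periodic t)

    φ-adjacent : ∀ k i → φ k ~ φ (nb k i)
    φ-adjacent k i with Compatible.matched compatible k i
    ... | j , M = ~-respʳ (sym (φ-nb k i j M)) (^-adjacent (shift k) (dartEnd-adjacent (orbit k) j))

    φ-locallyInjective : ∀ k {i i′} → φ (nb k i) ≡ φ (nb k i′) → i ≡ i′
    φ-locallyInjective k {i} {i′} e
      with Compatible.matched compatible k i | Compatible.matched compatible k i′
    ... | j , M | j′ , M′
      with dartEnd-injective (orbit k)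
             (^-injective (shift k) (trans (sym (φ-nb k i j M)) (trans e (φ-nb k i′ j′ M′))))
    ... | refl = Compatible.unambiguous compatible k i i′ j M M′

-- Certificates for the Heawood, Pappus and Desargues graphs

_⊕_ : ∀ {m} → Fin (suc m) → ℕ → Fin (suc m)
_⊕_ {m} k a = fromℕ< (m%n<n (toℕ k + a) (suc m))

-- k ⊕ m is k − 1.
lcfNeighbour : ∀ {m} (offs : List ℕ) .{{_ : NonZero (length offs)}} →
               Fin (suc m) → Fin 3 → Fin (suc m)
lcfNeighbour     offs k zero             = k ⊕ 1
lcfNeighbour {m} offs k (suc zero)       = k ⊕ m
lcfNeighbour     offs k (suc (suc zero)) = k ⊕ nth offs (toℕ k % length offs)

module _ (m : ℕ) (offs : List ℕ) .{{_ : NonZero (length offs)}} where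

  private
    lcfEdge? : ∀ k l → Dec (Adj (LCF (suc m) offs) k l)
    lcfEdge? k l = T? (lcfEdge (suc m) offs (toℕ k) (toℕ l))

  lcfCertificate : (X : VoltageGraph) (orbit : Fin (suc m) → Fin (VoltageGraph.orbits X))
    (shift : Fin (suc m) → ℕ) →
    {_ : True (NeighbourFunction.describes? (lcfNeighbour offs) lcfEdge?)} →
    {_ : True (Labelling.compatible? X (lcfNeighbour offs) orbit shift)} →
    Certificate m (Adj (LCF (suc m) offs))
  lcfCertificate X orbit shift {d} {c} = record
    { nb         = lcfNeighbour offs
    ; describes  = toWitness d
    ; voltages   = X
    ; orbit      = orbit
    ; shift      = shift
    ; compatible = toWitness c
    }

-- Orbits 0 and 1 are those of the hexagon vertex c₀ and its third neighbour d₀; the remaining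
-- representatives are named in heawood, pappus and desargues below.
heawoodCertificate : Certificate 13 (Adj Heawood)
heawoodCertificate = lcfCertificate 13 (5 ∷ 9 ∷ [])
  (record
    { orbits = 3
    ; period = lookup (6 ∷ 6 ∷ 2 ∷ [])
    ; period-nonZero = λ { zero → _ ; (suc zero) → _ ; (suc (suc zero)) → _ }
    ; dart = lookup ∘ lookup ( ((# 0 , 1) ∷ (# 0 , 5) ∷ (# 1 , 0) ∷ [])
                             ∷ ((# 0 , 0) ∷ (# 1 , 3) ∷ (# 2 , 0) ∷ [])
                             ∷ ((# 1 , 0) ∷ (# 1 , 2) ∷ (# 1 , 4) ∷ []) ∷ [])
    })
  (lookup (# 2 ∷ # 1 ∷ # 1 ∷ # 2 ∷ # 1 ∷ # 1 ∷ # 0 ∷ # 0 ∷ # 0 ∷ # 0 ∷ # 0 ∷ # 0 ∷ # 1 ∷ # 1 ∷ []))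
  (lookup (1 ∷ 1 ∷ 4 ∷ 0 ∷ 2 ∷ 5 ∷ 5 ∷ 4 ∷ 3 ∷ 2 ∷ 1 ∷ 0 ∷ 0 ∷ 3 ∷ []))

pappusCertificate : Certificate 17 (Adj Pappus)
pappusCertificate = lcfCertificate 17 (5 ∷ 7 ∷ 11 ∷ 7 ∷ 11 ∷ 13 ∷ [])
  (record
    { orbits = 3
    ; period = λ _ → 6
    ; period-nonZero = λ _ → _
    ; dart = lookup ∘ lookup ( ((# 0 , 1) ∷ (# 0 , 5) ∷ (# 1 , 0) ∷ [])
                             ∷ ((# 0 , 0) ∷ (# 2 , 0) ∷ (# 2 , 4) ∷ [])
                             ∷ ((# 1 , 0) ∷ (# 1 , 2) ∷ (# 2 , 3) ∷ []) ∷ [])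
    })
  (lookup ( # 1 ∷ # 0 ∷ # 0 ∷ # 1 ∷ # 2 ∷ # 2 ∷ # 1 ∷ # 0 ∷ # 0 ∷ # 1 ∷ # 2 ∷ # 2
          ∷ # 1 ∷ # 0 ∷ # 0 ∷ # 1 ∷ # 2 ∷ # 2 ∷ []))
  (lookup (5 ∷ 5 ∷ 4 ∷ 4 ∷ 2 ∷ 5 ∷ 1 ∷ 1 ∷ 0 ∷ 0 ∷ 4 ∷ 1 ∷ 3 ∷ 3 ∷ 2 ∷ 2 ∷ 0 ∷ 3 ∷ []))

desarguesCertificate : Certificate 19 (Adj Desargues)
desarguesCertificate = lcfCertificate 19 (5 ∷ 15 ∷ 9 ∷ 11 ∷ [])
  (record
    { orbits = 4
    ; period = lookup (6 ∷ 6 ∷ 2 ∷ 6 ∷ [])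
    ; period-nonZero = λ { zero → _ ; (suc zero) → _ ; (suc (suc zero)) → _
                         ; (suc (suc (suc zero))) → _ }
    ; dart = lookup ∘ lookup ( ((# 0 , 1) ∷ (# 0 , 5) ∷ (# 1 , 0) ∷ [])
                             ∷ ((# 0 , 0) ∷ (# 2 , 0) ∷ (# 3 , 0) ∷ [])
                             ∷ ((# 1 , 0) ∷ (# 1 , 2) ∷ (# 1 , 4) ∷ [])
                             ∷ ((# 1 , 0) ∷ (# 3 , 1) ∷ (# 3 , 5) ∷ []) ∷ [])
    })
  (lookup ( # 3 ∷ # 1 ∷ # 2 ∷ # 1 ∷ # 3 ∷ # 3 ∷ # 1 ∷ # 2 ∷ # 1 ∷ # 3 ∷ # 3 ∷ # 1
          ∷ # 0 ∷ # 0 ∷ # 0 ∷ # 0 ∷ # 0 ∷ # 0 ∷ # 1 ∷ # 3 ∷ []))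
  (lookup (0 ∷ 0 ∷ 0 ∷ 4 ∷ 4 ∷ 5 ∷ 5 ∷ 1 ∷ 3 ∷ 3 ∷ 2 ∷ 2 ∷ 2 ∷ 3 ∷ 4 ∷ 5 ∷ 0 ∷ 1 ∷ 1 ∷ 1 ∷ []))

-- The neighbourhood of a consistent hexagon

module ConsistentHexagon (Γ : Graph) (simple : IsSimple Γ) (cubic : Cubic Γ)
  (connected : Connected Γ) (girth : Girth Γ 6)
  (C : Cycle Γ 5) (γ : Automorphism Γ) (γ-rotates : ∀ i → fun γ (vert C i) ≡ vert C (next i))
  (arc-on-hexagon : (A : ThreeArc Γ) → Σ (Cycle Γ 5) (ArcOnCycle A)) where

  open Adjacency Γ
  open SimpleGraph Γ simple
  open CubicGraph Γ cubic
  open Girth6 Γ simple girth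
  open Powers γ
  open Modulo 6
  open Certified Γ simple cubic girth connected γ

  record Hexagon (x₀ x₁ x₂ x₃ : V Γ) : Set where
    field
      y z  : V Γ
      x₃~y : x₃ ~ y
      y~z  : y ~ z
      z~x₀ : z ~ x₀
      y≢x₀ : y ≢ x₀
      y≢x₂ : y ≢ x₂
      z≢x₁ : z ≢ x₁
      z≢x₃ : z ≢ x₃

  hexagon : ∀ {x₀ x₁ x₂ x₃} → x₀ ~ x₁ → x₁ ~ x₂ → x₂ ~ x₃ → x₀ ≢ x₂ → x₁ ≢ x₃ → Hexagon x₀ x₁ x₂ x₃
  hexagon x₀~x₁ x₁~x₂ x₂~x₃ x₀≢x₂ x₁≢x₃
    with arc-on-hexagon
           (record { a₀₁ = x₀~x₁ ; a₁₂ = x₁~x₂ ; a₂₃ = x₂~x₃ ; d₀₂ = x₀≢x₂ ; d₁₃ = x₁≢x₃ })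
  ... | D , i , refl , refl , refl , refl = record
    { y = at 4 ; z = at 5
    ; x₃~y = adj D (next^ 3 i) ; y~z = adj D (next^ 4 i)
    ; z~x₀ = ~-respʳ (cong (vert D) (next^6 i)) (adj D (next^ 5 i))
    ; y≢x₀ = apart (# 4) (# 0) (λ ()) ; y≢x₂ = apart (# 4) (# 2) (λ ())
    ; z≢x₁ = apart (# 5) (# 1) (λ ()) ; z≢x₃ = apart (# 5) (# 3) (λ ()) }
    where
    at : ℕ → V Γ
    at k = vert D (next^ k i)
    apart : ∀ (a b : Fin 6) → a ≢ b → at (toℕ a) ≢ at (toℕ b)
    apart a b a≢b e = a≢b (next^-injective i a b (inj D e))

  c₀ : V Γ
  c₀ = vert C zero

  c : ℕ → V Γ
  c k = (γ ^ k) c₀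

  ^-rotates : ∀ k i → (γ ^ k) (vert C i) ≡ vert C (next^ k i)
  ^-rotates zero    i = refl
  ^-rotates (suc k) i = trans (cong (fun γ) (^-rotates k i)) (γ-rotates (next^ k i))

  c-periodic : Periodic c₀
  c-periodic = ^-rotates 6 zero

  c≢c : ∀ (a b : Fin 6) → a ≢ b → c (toℕ a) ≢ c (toℕ b)
  c≢c a b a≢b e = a≢b (next^-injective zero a b
    (inj C (trans (sym (^-rotates (toℕ a) zero)) (trans e (^-rotates (toℕ b) zero)))))

  c₀~c₁ : c₀ ~ c 1
  c₀~c₁ = ~-respʳ (sym (^-rotates 1 zero)) (adj C zero)

  c₀~c₅ : c₀ ~ c 5
  c₀~c₅ = ~-sym (shift-~ 5 0 1 c-periodic c-periodic c₀~c₁)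

  opaque
    d₀ : V Γ
    d₀ = proj₁ (third-neighbour c₀~c₁ c₀~c₅ (c≢c (# 1) (# 5) (λ ())))

    N-c₀ : Neighbours c₀ (c 1) (c 5) d₀
    N-c₀ = proj₂ (third-neighbour c₀~c₁ c₀~c₅ (c≢c (# 1) (# 5) (λ ())))

  d : ℕ → V Γ
  d k = (γ ^ k) d₀

  d-periodic : Periodic d₀
  d-periodic = fixes-third (γ ^ 6) (^-adjacent 6) (^-injective 6) N-c₀
    c-periodic (periodic-^ 1 c-periodic) (periodic-^ 5 c-periodic)

  N-c : ∀ k → Neighbours (c ((k + 0) % 6)) (c ((k + 1) % 6)) (c ((k + 5) % 6)) (d ((k + 0) % 6))
  N-c k = shift-Neighbours k 0 1 5 0 c-periodic c-periodic c-periodic d-periodic N-c₀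

  c~c : ∀ k → c ((k + 0) % 6) ~ c ((k + 1) % 6)
  c~c k = Neighbours.x~a (N-c k)

  c~d : ∀ k → c ((k + 0) % 6) ~ d ((k + 0) % 6)
  c~d k = Neighbours.x~c (N-c k)

  c₀~d₀ : c₀ ~ d₀
  c₀~d₀ = c~d 0

  d₀≢c : ∀ (j : Fin 6) → d₀ ≢ c (toℕ j)
  d₀≢c zero                                = ≢-sym (~⇒≢ c₀~d₀)
  d₀≢c (suc zero)                          = ≢-sym (Neighbours.a≢c N-c₀)
  d₀≢c (suc (suc zero)) e                  = no-triangle c₀~c₁ (c~c 1) (~-sym (~-respʳ e c₀~d₀))
  d₀≢c (suc (suc (suc zero))) e            = no-quadrangle c₀~c₁ (c~c 1) (c~c 2)
    (~-sym (~-respʳ e c₀~d₀)) (c≢c (# 0) (# 2) (λ ())) (c≢c (# 1) (# 3) (λ ()))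
  d₀≢c (suc (suc (suc (suc zero)))) e      = no-triangle (~-respʳ e c₀~d₀) (c~c 4) (~-sym c₀~c₅)
  d₀≢c (suc (suc (suc (suc (suc zero))))) = ≢-sym (Neighbours.b≢c N-c₀)

  d₀≁c₁ : d₀ ≁ c 1
  d₀≁c₁ d₀~c₁ = no-triangle d₀~c₁ (~-sym c₀~c₁) c₀~d₀

  d₀≁c₂ : d₀ ≁ c 2
  d₀≁c₂ d₀~c₂ = no-quadrangle d₀~c₂ (~-sym (c~c 1)) (~-sym c₀~c₁) c₀~d₀
    (d₀≢c (# 1)) (c≢c (# 2) (# 0) (λ ()))

  d₀≁c₃ : d₀ ≁ c 3
  d₀≁c₃ d₀~c₃ = no-pentagon d₀~c₃ (~-sym (c~c 2)) (~-sym (c~c 1)) (~-sym c₀~c₁) c₀~d₀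

  d₀≁c₄ : d₀ ≁ c 4
  d₀≁c₄ d₀~c₄ = no-quadrangle d₀~c₄ (c~c 4) (c~c 5) c₀~d₀ (d₀≢c (# 5)) (c≢c (# 4) (# 0) (λ ()))

  d₀≁c₅ : d₀ ≁ c 5
  d₀≁c₅ d₀~c₅ = no-triangle d₀~c₅ (c~c 5) c₀~d₀

  d₀≢d₂ : d₀ ≢ d 2
  d₀≢d₂ e = d₀≁c₂ (~-sym (~-respʳ (sym e) (c~d 2)))

  d₀≢d₄ : d₀ ≢ d 4
  d₀≢d₄ e = d₀≁c₄ (~-sym (~-respʳ (sym e) (c~d 4)))

  d₂≢d₄ : d 2 ≢ d 4
  d₂≢d₄ = shift-≢ 2 0 2 d-periodic d-periodic d₀≢d₂

  d₀≁d₁ : d₀ ≁ d 1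
  d₀≁d₁ d₀~d₁ = no-quadrangle d₀~d₁ (~-sym (c~d 1)) (~-sym c₀~c₁) c₀~d₀
    (d₀≢c (# 1)) (shift-≢ 1 0 5 d-periodic c-periodic (d₀≢c (# 5)))

  d₀≁d₂ : d₀ ≁ d 2
  d₀≁d₂ d₀~d₂ = no-pentagon d₀~d₂ (~-sym (c~d 2)) (~-sym (c~c 1)) (~-sym c₀~c₁) c₀~d₀

  d₀≁d₄ : d₀ ≁ d 4
  d₀≁d₄ d₀~d₄ = no-pentagon d₀~d₄ (~-sym (c~d 4)) (c~c 4) (c~c 5) c₀~d₀

  d₀≁d₅ : d₀ ≁ d 5
  d₀≁d₅ d₀~d₅ = no-quadrangle d₀~d₅ (~-sym (c~d 5)) (c~c 5) c₀~d₀
    (d₀≢c (# 5)) (shift-≢ 5 0 1 d-periodic c-periodic (d₀≢c (# 1)))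

  d₀-neighbour≢c : ∀ {w} → d₀ ~ w → w ≢ c₀ → ∀ k → w ≢ c k
  d₀-neighbour≢c {w} d₀~w w≢c₀ = all-translates (w ≢_) c-periodic w≢cⱼ
    where
    w≢cⱼ : ∀ (j : Fin 6) → w ≢ c (toℕ j)
    w≢cⱼ zero                                  = w≢c₀
    w≢cⱼ (suc zero) e                          = d₀≁c₁ (~-respʳ e d₀~w)
    w≢cⱼ (suc (suc zero)) e                    = d₀≁c₂ (~-respʳ e d₀~w)
    w≢cⱼ (suc (suc (suc zero))) e              = d₀≁c₃ (~-respʳ e d₀~w)
    w≢cⱼ (suc (suc (suc (suc zero)))) e        = d₀≁c₄ (~-respʳ e d₀~w)
    w≢cⱼ (suc (suc (suc (suc (suc zero))))) e = d₀≁c₅ (~-respʳ e d₀~w)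

  d₀-neighbour≢d : ∀ {w} → d₀ ~ w → w ≢ d 3 → ∀ k → w ≢ d k
  d₀-neighbour≢d {w} d₀~w w≢d₃ = all-translates (w ≢_) d-periodic w≢dⱼ
    where
    w≢dⱼ : ∀ (j : Fin 6) → w ≢ d (toℕ j)
    w≢dⱼ zero                                  = ≢-sym (~⇒≢ d₀~w)
    w≢dⱼ (suc zero) e                          = d₀≁d₁ (~-respʳ e d₀~w)
    w≢dⱼ (suc (suc zero)) e                    = d₀≁d₂ (~-respʳ e d₀~w)
    w≢dⱼ (suc (suc (suc zero)))                = w≢d₃
    w≢dⱼ (suc (suc (suc (suc zero)))) e        = d₀≁d₄ (~-respʳ e d₀~w)
    w≢dⱼ (suc (suc (suc (suc (suc zero))))) e = d₀≁d₅ (~-respʳ e d₀~w)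

  ≁c : ∀ {w} → (∀ k → w ≢ c k) → (∀ k → w ≢ d k) → ∀ k → w ≁ c ((k + 0) % 6)
  ≁c w≢c w≢d k w~c with exhaust (N-c k) (~-sym w~c)
  ... | inj₁ w≡c        = w≢c ((k + 1) % 6) w≡c
  ... | inj₂ (inj₁ w≡c) = w≢c ((k + 5) % 6) w≡c
  ... | inj₂ (inj₂ w≡d) = w≢d ((k + 0) % 6) w≡d

  Neighbours-of-period₂ : ∀ {x} → (γ ^ 2) x ≡ x → x ~ d₀ → Neighbours x d₀ (d 2) (d 4)
  Neighbours-of-period₂ {x} γ²x≡x x~d₀ = record
    { x~a = x~d₀
    ; x~b = ~-respˡ γ²x≡x (shift-~ 2 0 0 x-periodic d-periodic x~d₀)
    ; x~c = ~-respˡ (trans (cong (γ ^ 2) γ²x≡x) γ²x≡x) (shift-~ 4 0 0 x-periodic d-periodic x~d₀)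
    ; a≢b = d₀≢d₂ ; a≢c = d₀≢d₄ ; b≢c = d₂≢d₄ }
    where
    x-periodic : Periodic x
    x-periodic = ^-* 2 γ²x≡x 3

  heawood : ∀ {x} → Neighbours d₀ c₀ (d 3) x → (γ ^ 2) x ≡ x → Iso Γ Heawood
  heawood {x} N-d₀ γ²x≡x = certified-iso heawoodCertificate (record
    { rep        = lookup (c₀ ∷ d₀ ∷ x ∷ [])
    ; periodic   = λ { zero → c-periodic ; (suc zero) → d-periodic ; (suc (suc zero)) → γ²x≡x }
    ; neighbours = λ { zero → N-c₀ ; (suc zero) → N-d₀ ; (suc (suc zero)) → N-x }
    })
    where
    N-x : Neighbours x d₀ (d 2) (d 4)
    N-x = Neighbours-of-period₂ γ²x≡x (~-sym (Neighbours.x~c N-d₀))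

  pappus : ∀ {e₀} → Periodic e₀ → Neighbours d₀ c₀ e₀ ((γ ^ 4) e₀) →
           Neighbours e₀ d₀ (d 2) ((γ ^ 3) e₀) → Iso Γ Pappus
  pappus {e₀} e-periodic N-d₀ N-e₀ = certified-iso pappusCertificate (record
    { rep        = lookup (c₀ ∷ d₀ ∷ e₀ ∷ [])
    ; periodic   = λ { zero → c-periodic ; (suc zero) → d-periodic ; (suc (suc zero)) → e-periodic }
    ; neighbours = λ { zero → N-c₀ ; (suc zero) → N-d₀ ; (suc (suc zero)) → N-e₀ }
    })

  desargues : ∀ {e₀ g₀} → (γ ^ 2) e₀ ≡ e₀ → Periodic g₀ → Neighbours d₀ c₀ e₀ g₀ →
              Neighbours e₀ d₀ (d 2) (d 4) → Neighbours g₀ d₀ ((γ ^ 1) g₀) ((γ ^ 5) g₀) →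
              Iso Γ Desargues
  desargues {e₀} {g₀} γ²e≡e g-periodic N-d₀ N-e₀ N-g₀ = certified-iso desarguesCertificate (record
    { rep        = lookup (c₀ ∷ d₀ ∷ e₀ ∷ g₀ ∷ [])
    ; periodic   = λ { zero → c-periodic ; (suc zero) → d-periodic
                     ; (suc (suc zero)) → γ²e≡e ; (suc (suc (suc zero))) → g-periodic }
    ; neighbours = λ { zero → N-c₀ ; (suc zero) → N-d₀
                     ; (suc (suc zero)) → N-e₀ ; (suc (suc (suc zero))) → N-g₀ }
    })

  module Case-d₀~d₃ (d₀~d₃ : d₀ ~ d 3) where

    private
      c₀≢d₃ : c₀ ≢ d 3
      c₀≢d₃ e = d₀≢c (# 3) (shift-≡ 3 3 0 d-periodic c-periodic (sym e))

    opaque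
      f₀ : V Γ
      f₀ = proj₁ (third-neighbour (~-sym c₀~d₀) d₀~d₃ c₀≢d₃)

      N-d₀ : Neighbours d₀ c₀ (d 3) f₀
      N-d₀ = proj₂ (third-neighbour (~-sym c₀~d₀) d₀~d₃ c₀≢d₃)

    f : ℕ → V Γ
    f k = (γ ^ k) f₀

    f-periodic : Periodic f₀
    f-periodic = fixes-third (γ ^ 6) (^-adjacent 6) (^-injective 6) N-d₀
      d-periodic c-periodic (periodic-^ 3 d-periodic)

    N-d : ∀ k → Neighbours (d ((k + 0) % 6)) (c ((k + 0) % 6)) (d ((k + 3) % 6)) (f ((k + 0) % 6))
    N-d k = shift-Neighbours k 0 0 3 0 d-periodic c-periodic d-periodic f-periodic N-d₀

    d₀~f₀ : d₀ ~ f₀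
    d₀~f₀ = Neighbours.x~c N-d₀

    f₀≢c : ∀ k → f₀ ≢ c k
    f₀≢c = d₀-neighbour≢c d₀~f₀ (≢-sym (Neighbours.a≢c N-d₀))

    f₀≢d : ∀ k → f₀ ≢ d k
    f₀≢d = d₀-neighbour≢d d₀~f₀ (≢-sym (Neighbours.b≢c N-d₀))

    f₀≁c : ∀ k → f₀ ≁ c ((k + 0) % 6)
    f₀≁c = ≁c f₀≢c f₀≢d

    module Case-f₀~f₁ (f₀~f₁ : f₀ ~ f 1) where

      private
        f₀≢f₄ : f₀ ≢ f 4
        f₀≢f₄ f₀≡f₄ with exhaust (Neighbours-of-period₂ γ²f≡f (~-sym d₀~f₀)) f₀~f₁
          where
          γ²f≡f : (γ ^ 2) f₀ ≡ f₀
          γ²f≡f = shift-≡ 2 0 4 f-periodic f-periodic f₀≡f₄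
        ... | inj₁ f₁≡d₀        = f₀≢d 5 (shift-≡ 5 1 0 f-periodic d-periodic f₁≡d₀)
        ... | inj₂ (inj₁ f₁≡d₂) = f₀≢d 1 (shift-≡ 5 1 2 f-periodic d-periodic f₁≡d₂)
        ... | inj₂ (inj₂ f₁≡d₄) = f₀≢d 3 (shift-≡ 5 1 4 f-periodic d-periodic f₁≡d₄)

        N-f₀ : Neighbours f₀ d₀ (f 1) (f 5)
        N-f₀ = record
          { x~a = ~-sym d₀~f₀ ; x~b = f₀~f₁
          ; x~c = ~-sym (shift-~ 5 0 1 f-periodic f-periodic f₀~f₁)
          ; a≢b = λ e → f₀≢d 5 (sym (shift-≡ 5 0 1 d-periodic f-periodic e))
          ; a≢c = λ e → f₀≢d 1 (sym (shift-≡ 1 0 5 d-periodic f-periodic e))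
          ; b≢c = λ e → f₀≢f₄ (shift-≡ 5 1 5 f-periodic f-periodic e) }

        open Hexagon (hexagon (c~d 3) (~-sym d₀~d₃) d₀~f₀ (≢-sym (d₀≢c (# 3))) (≢-sym (f₀≢d 3)))

      absurd : ⊥
      absurd with exhaust N-f₀ x₃~y | exhaust (N-c 3) (~-sym z~x₀)
      ... | inj₁ y≡d₀        | _                 = y≢x₂ y≡d₀
      ... | _                | inj₂ (inj₂ z≡d₃) = z≢x₁ z≡d₃
      ... | inj₂ (inj₁ y≡f₁) | inj₁ z≡c₄        =
        f₀≁c 3 (shift-~ 5 1 4 f-periodic c-periodic (subst₂ _~_ y≡f₁ z≡c₄ y~z))
      ... | inj₂ (inj₁ y≡f₁) | inj₂ (inj₁ z≡c₂) =
        f₀≁c 1 (shift-~ 5 1 2 f-periodic c-periodic (subst₂ _~_ y≡f₁ z≡c₂ y~z))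
      ... | inj₂ (inj₂ y≡f₅) | inj₁ z≡c₄        =
        f₀≁c 5 (shift-~ 1 5 4 f-periodic c-periodic (subst₂ _~_ y≡f₅ z≡c₄ y~z))
      ... | inj₂ (inj₂ y≡f₅) | inj₂ (inj₁ z≡c₂) =
        f₀≁c 3 (shift-~ 1 5 2 f-periodic c-periodic (subst₂ _~_ y≡f₅ z≡c₂ y~z))

    f₀≁f₁ : f₀ ≁ f 1
    f₀≁f₁ = Case-f₀~f₁.absurd

    private
      open Hexagon (hexagon (~-sym d₀~f₀) (~-sym c₀~d₀) c₀~c₁ (f₀≢c 0) (d₀≢c (# 1)))

      heawood-via-d₂ : f₀ ~ d 2 → Iso Γ Heawood
      heawood-via-d₂ f₀~d₂ with exhaust (N-d 2) (~-sym f₀~d₂)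
      ... | inj₁ f₀≡c₂        = ⊥-elim (f₀≢c 2 f₀≡c₂)
      ... | inj₂ (inj₁ f₀≡d₅) = ⊥-elim (f₀≢d 5 f₀≡d₅)
      ... | inj₂ (inj₂ f₀≡f₂) = heawood N-d₀ (sym f₀≡f₂)

      heawood-via-d₄ : f₀ ~ d 4 → Iso Γ Heawood
      heawood-via-d₄ f₀~d₄ with exhaust (N-d 4) (~-sym f₀~d₄)
      ... | inj₁ f₀≡c₄        = ⊥-elim (f₀≢c 4 f₀≡c₄)
      ... | inj₂ (inj₁ f₀≡d₁) = ⊥-elim (f₀≢d 1 f₀≡d₁)
      ... | inj₂ (inj₂ f₀≡f₄) = heawood N-d₀ (shift-≡ 2 0 4 f-periodic f-periodic f₀≡f₄)

    heawood-iso : Iso Γ Heawood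
    heawood-iso with exhaust (N-c 1) x₃~y
    ... | inj₂ (inj₁ y≡c₀) = ⊥-elim (y≢x₂ y≡c₀)
    ... | inj₁ y≡c₂ with exhaust (N-c 2) (~-respˡ y≡c₂ y~z)
    ...   | inj₁ z≡c₃        = ⊥-elim (f₀≁c 3 (~-sym (~-respˡ z≡c₃ z~x₀)))
    ...   | inj₂ (inj₁ z≡c₁) = ⊥-elim (z≢x₃ z≡c₁)
    ...   | inj₂ (inj₂ z≡d₂) = heawood-via-d₂ (~-sym (~-respˡ z≡d₂ z~x₀))
    heawood-iso | inj₂ (inj₂ y≡d₁) with exhaust (N-d 1) (~-respˡ y≡d₁ y~z)
    ...   | inj₁ z≡c₁        = ⊥-elim (z≢x₃ z≡c₁)
    ...   | inj₂ (inj₁ z≡d₄) = heawood-via-d₄ (~-sym (~-respˡ z≡d₄ z~x₀))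
    ...   | inj₂ (inj₂ z≡f₁) = ⊥-elim (f₀≁f₁ (~-sym (~-respˡ z≡f₁ z~x₀)))

  module Case-common-neighbour {e₀} (d₂~e₀ : d 2 ~ e₀) (e₀~d₀ : e₀ ~ d₀) (e₀≢c₀ : e₀ ≢ c₀) where

    e : ℕ → V Γ
    e k = (γ ^ k) e₀

    d₀~e₀ : d₀ ~ e₀
    d₀~e₀ = ~-sym e₀~d₀

    e₀~d₂ : e₀ ~ d 2
    e₀~d₂ = ~-sym d₂~e₀

    e₀≢c : ∀ k → e₀ ≢ c k
    e₀≢c = d₀-neighbour≢c d₀~e₀ e₀≢c₀

    e₀≢d : ∀ k → e₀ ≢ d k
    e₀≢d = d₀-neighbour≢d d₀~e₀ λ e₀≡d₃ →
      d₀≁d₅ (shift-~ 3 3 2 d-periodic d-periodic (~-respˡ e₀≡d₃ e₀~d₂))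

    -- γ⁶e₀ is a common neighbour of d₀ and d₂ as well, and two of them would span a quadrangle.
    e-periodic : Periodic e₀
    e-periodic with neighbour-≟ d₀~γ⁶e₀ d₀~e₀
      where
      d₀~γ⁶e₀ : d₀ ~ (γ ^ 6) e₀
      d₀~γ⁶e₀ = ~-respˡ d-periodic (^-adjacent 6 d₀~e₀)
    ... | yes γ⁶e₀≡e₀ = γ⁶e₀≡e₀
    ... | no  γ⁶e₀≢e₀ = ⊥-elim (no-quadrangle d₀~e₀ e₀~d₂
          (~-respˡ (periodic-^ 2 d-periodic) (^-adjacent 6 d₂~e₀))
          (~-sym (~-respˡ d-periodic (^-adjacent 6 d₀~e₀))) d₀≢d₂ (≢-sym γ⁶e₀≢e₀))

    d₀~e₄ : d₀ ~ e 4
    d₀~e₄ = shift-~ 4 2 0 d-periodic e-periodic d₂~e₀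

    module Case-e₀≡e₄ (e₀≡e₄ : e₀ ≡ e 4) where

      γ²e≡e : (γ ^ 2) e₀ ≡ e₀
      γ²e≡e = shift-≡ 2 0 4 e-periodic e-periodic e₀≡e₄

      N-e₀ : Neighbours e₀ d₀ (d 2) (d 4)
      N-e₀ = Neighbours-of-period₂ γ²e≡e e₀~d₀

      opaque
        g₀ : V Γ
        g₀ = proj₁ (third-neighbour (~-sym c₀~d₀) d₀~e₀ (≢-sym e₀≢c₀))

        N-d₀ : Neighbours d₀ c₀ e₀ g₀
        N-d₀ = proj₂ (third-neighbour (~-sym c₀~d₀) d₀~e₀ (≢-sym e₀≢c₀))

      g : ℕ → V Γ
      g k = (γ ^ k) g₀

      g-periodic : Periodic g₀
      g-periodic = fixes-third (γ ^ 6) (^-adjacent 6) (^-injective 6) N-d₀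
        d-periodic c-periodic e-periodic

      N-d : ∀ k → Neighbours (d ((k + 0) % 6)) (c ((k + 0) % 6)) (e ((k + 0) % 6)) (g ((k + 0) % 6))
      N-d k = shift-Neighbours k 0 0 0 0 d-periodic c-periodic e-periodic g-periodic N-d₀

      d₀~g₀ : d₀ ~ g₀
      d₀~g₀ = Neighbours.x~c N-d₀

      g₀≢c : ∀ k → g₀ ≢ c k
      g₀≢c = d₀-neighbour≢c d₀~g₀ (≢-sym (Neighbours.a≢c N-d₀))

      heawood-via-d₃ : g₀ ≡ d 3 → Iso Γ Heawood
      heawood-via-d₃ g₀≡d₃ = heawood (record
        { x~a = Neighbours.x~a N-d₀ ; x~b = ~-respʳ g₀≡d₃ d₀~g₀ ; x~c = d₀~e₀
        ; a≢b = λ c₀≡d₃ → Neighbours.a≢c N-d₀ (trans c₀≡d₃ (sym g₀≡d₃))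
        ; a≢c = Neighbours.a≢b N-d₀
        ; b≢c = λ d₃≡e₀ → Neighbours.b≢c N-d₀ (sym (trans g₀≡d₃ d₃≡e₀)) }) γ²e≡e

      desargues-via-g₁ : g₀ ~ g 1 → Iso Γ Desargues
      desargues-via-g₁ g₀~g₁ = desargues γ²e≡e g-periodic N-d₀ N-e₀ (record
        { x~a = ~-sym d₀~g₀ ; x~b = g₀~g₁
        ; x~c = ~-sym (shift-~ 5 0 1 g-periodic g-periodic g₀~g₁)
        ; a≢b = λ d₀≡g₁ → d₀≁d₅ (~-respʳ (sym (shift-≡ 5 0 1 d-periodic g-periodic d₀≡g₁)) d₀~g₀)
        ; a≢c = λ d₀≡g₅ → d₀≁d₁ (~-respʳ (sym (shift-≡ 1 0 5 d-periodic g-periodic d₀≡g₅)) d₀~g₀)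
        ; b≢c = λ g₁≡g₅ → no-quadrangle d₀~g₀
            (~-respˡ (sym (shift-≡ 5 1 5 g-periodic g-periodic g₁≡g₅))
              (shift-~ 4 0 0 g-periodic d-periodic (~-sym d₀~g₀)))
            (~-sym (Neighbours.x~c N-e₀)) e₀~d₀ d₀≢d₄ (≢-sym (Neighbours.b≢c N-d₀)) })

      open Hexagon (hexagon (~-sym c₀~c₁) c₀~d₀ d₀~g₀ (≢-sym (d₀≢c (# 1))) (Neighbours.a≢c N-d₀))

      classification : Iso Γ Heawood ⊎ Iso Γ Desargues
      classification with exhaust (N-c 1) (~-sym z~x₀)
      ... | inj₂ (inj₁ z≡c₀) = ⊥-elim (z≢x₁ z≡c₀)
      ... | inj₁ z≡c₂ with exhaust (N-c 2) (~-sym (~-respʳ z≡c₂ y~z))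
      ...   | inj₂ (inj₁ y≡c₁) = ⊥-elim (y≢x₀ y≡c₁)
      ...   | inj₂ (inj₂ y≡d₂) = ⊥-elim (no-quadrangle d₀~e₀ e₀~d₂ (~-sym (~-respʳ y≡d₂ x₃~y))
                                   (~-sym d₀~g₀) d₀≢d₂ (Neighbours.b≢c N-d₀))
      ...   | inj₁ y≡c₃ with exhaust (N-c 3) (~-sym (~-respʳ y≡c₃ x₃~y))
      ...     | inj₁ g₀≡c₄        = ⊥-elim (g₀≢c 4 g₀≡c₄)
      ...     | inj₂ (inj₁ g₀≡c₂) = ⊥-elim (g₀≢c 2 g₀≡c₂)
      ...     | inj₂ (inj₂ g₀≡d₃) = inj₁ (heawood-via-d₃ g₀≡d₃)
      classification | inj₂ (inj₂ z≡d₁) with exhaust (N-d 1) (~-sym (~-respʳ z≡d₁ y~z))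
      ...   | inj₁ y≡c₁        = ⊥-elim (y≢x₀ y≡c₁)
      ...   | inj₂ (inj₂ y≡g₁) = inj₂ (desargues-via-g₁ (~-respʳ y≡g₁ x₃~y))
      ...   | inj₂ (inj₁ y≡e₁)
        with exhaust (shift-Neighbours 1 0 0 2 4 e-periodic d-periodic d-periodic d-periodic N-e₀)
                     (~-sym (~-respʳ y≡e₁ x₃~y))
      ...     | inj₁ g₀≡d₁        = ⊥-elim (d₀≁d₁ (~-respʳ g₀≡d₁ d₀~g₀))
      ...     | inj₂ (inj₁ g₀≡d₃) = inj₁ (heawood-via-d₃ g₀≡d₃)
      ...     | inj₂ (inj₂ g₀≡d₅) = ⊥-elim (d₀≁d₅ (~-respʳ g₀≡d₅ d₀~g₀))

    module Case-e₀≢e₄ (e₀≢e₄ : e₀ ≢ e 4) where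

      N-d₀ : Neighbours d₀ c₀ e₀ (e 4)
      N-d₀ = record
        { x~a = ~-sym c₀~d₀ ; x~b = d₀~e₀ ; x~c = d₀~e₄ ; a≢b = ≢-sym e₀≢c₀
        ; a≢c = λ c₀≡e₄ → e₀≢c 2 (sym (shift-≡ 2 0 4 c-periodic e-periodic c₀≡e₄)) ; b≢c = e₀≢e₄ }

      N-d : ∀ k → Neighbours (d ((k + 0) % 6)) (c ((k + 0) % 6)) (e ((k + 0) % 6)) (e ((k + 4) % 6))
      N-d k = shift-Neighbours k 0 0 0 4 d-periodic c-periodic e-periodic e-periodic N-d₀

      e₀≢e₂ : e₀ ≢ e 2
      e₀≢e₂ e₀≡e₂ = e₀≢e₄ (trans e₀≡e₂ (shift-≡ 2 0 2 e-periodic e-periodic e₀≡e₂))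

      e₀≁c : ∀ k → e₀ ≁ c ((k + 0) % 6)
      e₀≁c = ≁c e₀≢c e₀≢d

      e₀≁e₁ : e₀ ≁ e 1
      e₀≁e₁ e₀~e₁ with exhaust N-e₀ (~-sym (shift-~ 5 0 1 e-periodic e-periodic e₀~e₁))
        where
        N-e₀ : Neighbours e₀ d₀ (d 2) (e 1)
        N-e₀ = record
          { x~a = e₀~d₀ ; x~b = e₀~d₂ ; x~c = e₀~e₁ ; a≢b = d₀≢d₂
          ; a≢c = λ d₀≡e₁ → e₀≢d 5 (sym (shift-≡ 5 0 1 d-periodic e-periodic d₀≡e₁))
          ; b≢c = λ d₂≡e₁ → e₀≢d 1 (sym (shift-≡ 5 2 1 d-periodic e-periodic d₂≡e₁)) }
      ... | inj₁ e₅≡d₀        = e₀≢d 1 (shift-≡ 1 5 0 e-periodic d-periodic e₅≡d₀)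
      ... | inj₂ (inj₁ e₅≡d₂) = e₀≢d 3 (shift-≡ 1 5 2 e-periodic d-periodic e₅≡d₂)
      ... | inj₂ (inj₂ e₅≡e₁) = e₀≢e₂ (shift-≡ 1 5 1 e-periodic e-periodic e₅≡e₁)

      opaque
        h₀ : V Γ
        h₀ = proj₁ (third-neighbour e₀~d₀ e₀~d₂ d₀≢d₂)

        N-e₀ : Neighbours e₀ d₀ (d 2) h₀
        N-e₀ = proj₂ (third-neighbour e₀~d₀ e₀~d₂ d₀≢d₂)

      e₀~h₀ : e₀ ~ h₀
      e₀~h₀ = Neighbours.x~c N-e₀

      h₀≢c : ∀ k → h₀ ≢ c ((k + 0) % 6)
      h₀≢c k h₀≡c = e₀≁c k (~-respʳ h₀≡c e₀~h₀)

      h₀≢e₁ : h₀ ≢ e 1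
      h₀≢e₁ h₀≡e₁ = e₀≁e₁ (~-respʳ h₀≡e₁ e₀~h₀)

      h₀≢e₅ : h₀ ≢ e 5
      h₀≢e₅ h₀≡e₅ = e₀≁e₁ (~-sym (shift-~ 1 0 5 e-periodic e-periodic (~-respʳ h₀≡e₅ e₀~h₀)))

      pappus-via-e₃ : e₀ ~ e 3 → Iso Γ Pappus
      pappus-via-e₃ e₀~e₃ = pappus e-periodic N-d₀ (record
        { x~a = e₀~d₀ ; x~b = e₀~d₂ ; x~c = e₀~e₃ ; a≢b = d₀≢d₂
        ; a≢c = λ d₀≡e₃ → e₀≢d 3 (sym (shift-≡ 3 0 3 d-periodic e-periodic d₀≡e₃))
        ; b≢c = λ d₂≡e₃ → e₀≢d 5 (sym (shift-≡ 3 2 3 d-periodic e-periodic d₂≡e₃)) })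

      open Hexagon (hexagon c₀~d₀ d₀~e₀ e₀~h₀ (≢-sym e₀≢c₀) (Neighbours.a≢c N-e₀))

      pappus-iso : Iso Γ Pappus
      pappus-iso with exhaust N-c₀ (~-sym z~x₀)
      ... | inj₂ (inj₂ z≡d₀) = ⊥-elim (z≢x₁ z≡d₀)
      ... | inj₁ z≡c₁ with exhaust (N-c 1) (~-sym (~-respʳ z≡c₁ y~z))
      ...   | inj₂ (inj₁ y≡c₀) = ⊥-elim (y≢x₀ y≡c₀)
      ...   | inj₁ y≡c₂ with exhaust (N-c 2) (~-sym (~-respʳ y≡c₂ x₃~y))
      ...     | inj₁ h₀≡c₃        = ⊥-elim (h₀≢c 3 h₀≡c₃)
      ...     | inj₂ (inj₁ h₀≡c₁) = ⊥-elim (h₀≢c 1 h₀≡c₁)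
      ...     | inj₂ (inj₂ h₀≡d₂) = ⊥-elim (Neighbours.b≢c N-e₀ (sym h₀≡d₂))
      pappus-iso | inj₁ z≡c₁ | inj₂ (inj₂ y≡d₁) with exhaust (N-d 1) (~-sym (~-respʳ y≡d₁ x₃~y))
      ...     | inj₁ h₀≡c₁        = ⊥-elim (h₀≢c 1 h₀≡c₁)
      ...     | inj₂ (inj₁ h₀≡e₁) = ⊥-elim (h₀≢e₁ h₀≡e₁)
      ...     | inj₂ (inj₂ h₀≡e₅) = ⊥-elim (h₀≢e₅ h₀≡e₅)
      pappus-iso | inj₂ (inj₁ z≡c₅) with exhaust (N-c 5) (~-sym (~-respʳ z≡c₅ y~z))
      ...   | inj₁ y≡c₀ = ⊥-elim (y≢x₀ y≡c₀)
      ...   | inj₂ (inj₁ y≡c₄) with exhaust (N-c 4) (~-sym (~-respʳ y≡c₄ x₃~y))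
      ...     | inj₁ h₀≡c₅        = ⊥-elim (h₀≢c 5 h₀≡c₅)
      ...     | inj₂ (inj₁ h₀≡c₃) = ⊥-elim (h₀≢c 3 h₀≡c₃)
      ...     | inj₂ (inj₂ h₀≡d₄) with exhaust (N-d 4) (~-sym (~-respʳ h₀≡d₄ e₀~h₀))
      ...       | inj₁ e₀≡c₄        = ⊥-elim (e₀≢c 4 e₀≡c₄)
      ...       | inj₂ (inj₁ e₀≡e₄) = ⊥-elim (e₀≢e₄ e₀≡e₄)
      ...       | inj₂ (inj₂ e₀≡e₂) = ⊥-elim (e₀≢e₂ e₀≡e₂)
      pappus-iso | inj₂ (inj₁ z≡c₅) | inj₂ (inj₂ y≡d₅)
        with exhaust (N-d 5) (~-sym (~-respʳ y≡d₅ x₃~y))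
      ...     | inj₁ h₀≡c₅        = ⊥-elim (h₀≢c 5 h₀≡c₅)
      ...     | inj₂ (inj₁ h₀≡e₅) = ⊥-elim (h₀≢e₅ h₀≡e₅)
      ...     | inj₂ (inj₂ h₀≡e₃) = pappus-via-e₃ (~-respʳ h₀≡e₃ e₀~h₀)

    classification : Iso Γ Heawood ⊎ Iso Γ Pappus ⊎ Iso Γ Desargues
    classification with neighbour-≟ d₀~e₀ d₀~e₄
    ... | no  e₀≢e₄ = inj₂ (inj₁ (Case-e₀≢e₄.pappus-iso e₀≢e₄))
    ... | yes e₀≡e₄ with Case-e₀≡e₄.classification e₀≡e₄
    ...   | inj₁ Γ≅Heawood   = inj₁ Γ≅Heawood
    ...   | inj₂ Γ≅Desargues = inj₂ (inj₂ Γ≅Desargues)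

  open Hexagon (hexagon (~-sym c₀~d₀) c₀~c₁ (c~c 1) (d₀≢c (# 1)) (c≢c (# 0) (# 2) (λ ())))

  -- The 3-arc d₀c₀c₁c₂ closes to a hexagon d₀c₀c₁c₂yz; either y = d₂ and z is a common neighbour
  -- of d₀ and d₂, or y = c₃ and then z = d₃.
  classification : Iso Γ Heawood ⊎ Iso Γ Pappus ⊎ Iso Γ Desargues
  classification with exhaust (N-c 2) x₃~y
  ... | inj₂ (inj₁ y≡c₁) = ⊥-elim (y≢x₂ y≡c₁)
  ... | inj₂ (inj₂ y≡d₂) =
    Case-common-neighbour.classification (~-respˡ y≡d₂ y~z) z~x₀ z≢x₁
  ... | inj₁ y≡c₃ with exhaust (N-c 3) (~-respˡ y≡c₃ y~z)
  ...   | inj₁ z≡c₄        = ⊥-elim (d₀≁c₄ (~-sym (~-respˡ z≡c₄ z~x₀)))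
  ...   | inj₂ (inj₁ z≡c₂) = ⊥-elim (z≢x₃ z≡c₂)
  ...   | inj₂ (inj₂ z≡d₃) = inj₁ (Case-d₀~d₃.heawood-iso (~-sym (~-respˡ z≡d₃ z~x₀)))

mainTheorem6 : (Γ : Graph) → IsSimple Γ → Cubic Γ → Connected Γ → Girth Γ 6
    → Σ (Cycle Γ 5) Consistent
    → ((A : ThreeArc Γ) → Σ (Cycle Γ 5) (ArcOnCycle A))
    → Iso Γ Heawood ⊎ Iso Γ Pappus ⊎ Iso Γ Desargues
mainTheorem6 Γ simple cubic connected girth (C , γ , γ-rotates) arc-on-hexagon =
  ConsistentHexagon.classification Γ simple cubic connected girth C γ γ-rotates arc-on-hexagon
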